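{- Let $N\ge 1$ and let $f:\{0,\dots,N-1\}\to\{0,\dots,N-1\}$ be a function. Let $(C_0,\dots,C_{\ell-1})$ be the greedy orbit decomposition of $f$. For each $i$ let $v_i$ be the last element of $C_i$. Call $C_i$ a $\rho$-orbit if $f(v_i)\in C_i$; otherwise $f(v_i)\in C_{j(i)}$ for a unique index $j(i)<i$. For each $i$, the number of descents from $C_i$ is the number $d(i)$ of steps in the sequence $i, j(i), j(j(i)),\dots$ until an index $k$ with $C_k$ a $\rho$-orbit is reached (so $d(i)=0$ if $C_i$ is a $\rho$-orbit), and the maximal number of descents of $f$ is $\max_i d(i)$. Then the maximal number of descents of $f$ is at most $\left\lfloor\frac{\sqrt{1+8N}-3}{2}\right\rfloor$.
   Context: The graph of $f$ is the directed graph with vertex set $V=\{0,\dots,N-1\}$ and edges $(x,f(x))$. For a subset $W\subseteq V$, consider the subgraph induced on $W$ (edges $(x,f(x))$ with both $x,f(x)\in W$). In such an induced subgraph, the orbit of a vertex $v$ is the maximal simple directed path $(v,v_1,\dots,v_k)$ starting at $v$ (obtained by following edges until either there is no outgoing edge in the subgraph or the next vertex would repeat one already visited). The greedy orbit decomposition $(C_0,\dots,C_{\ell-1})$ of $f$ is defined as follows: $C_0$ is an orbit of maximal length in the graph of $f$ (among orbits of maximal length, the one whose starting vertex is least); for $k>0$, if $V\ne C_0\cup\dots\cup C_{k-1}$, $C_k$ is an orbit of maximal length in the subgraph induced on $V\setminus(C_0\cup\dots\cup C_{k-1})$ (ties again broken by least starting vertex); $\ell$ is the least $k$ with $V=C_0\cup\dots\cup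 C_{k-1}$. Each $C_i$ is regarded as a sequence ordered along its path, so its last element is well defined. -}

module Defs where

open import Data.Nat using (ℕ; zero; suc; _+_; _*_; _∸_; _≤_; _≤?_; _/_)
open import Data.Bool using (Bool; true; false; if_then_else_)
open import Data.Fin as Fin using (Fin)
open import Data.List using (List; []; _∷_; length; _++_; allFin; last; lookup)
open import Data.List.Membership.Propositional using (_∈_)
import Data.List.Membership.DecPropositional as DecMem
open import Data.Maybe using (Maybe; just; nothing)
open import Relation.Nullary using (¬_; does)
open import Relation.Binary.PropositionalEquality using (_≡_)

isqrt-go : ℕ → ℕ → ℕ
isqrt-go x zero = zero
isqrt-go x (suc k) = if does (suc k * suc k ≤? x) then suc k else isqrt-go x k

⌊√_⌋ : ℕ → ℕ
⌊√ x ⌋ = isqrt-go x x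

-- ⌊ (√(1+8N) - 3) / 2 ⌋  (for N ≥ 1, √(1+8N) ≥ 3, and the nested floors agree)
descentBound : ℕ → ℕ
descentBound N = (⌊√ (1 + 8 * N) ⌋ ∸ 3) / 2

module Greedy {N : ℕ} (f : Fin N → Fin N) where

  open DecMem {A = Fin N} Fin._≟_ using (_∈?_)

  -- Orbit of x in the subgraph induced on the complement of `avoid`
  -- (x itself is assumed to lie outside `avoid`).
  -- The fuel N is never exhausted, since a simple path has ≤ N vertices.
  orbitGo : ℕ → List (Fin N) → Fin N → List (Fin N)
  orbitGo zero avoid x = x ∷ []
  orbitGo (suc k) avoid x =
    x ∷ (if does (f x ∈? (x ∷ avoid)) then [] else orbitGo k (x ∷ avoid) (f x))

  orbit : List (Fin N) → Fin N → List (Fin N)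
  orbit used v = orbitGo N used v

  -- among the vertices not in `used`, scanned in increasing order, keep the
  -- first one achieving the maximal orbit length (strict improvement only,
  -- so ties are broken by the least starting vertex)
  bestGo : List (Fin N) → List (Fin N) → Maybe (List (Fin N)) → Maybe (List (Fin N))
  bestGo used [] acc = acc
  bestGo used (v ∷ vs) acc with does (v ∈? used)
  ... | true = bestGo used vs acc
  ... | false with acc
  ...   | nothing = bestGo used vs (just (orbit used v))
  ...   | just o = bestGo used vs
                     (if does (suc (length o) ≤? length (orbit used v))
                        then just (orbit used v) else just o)

  bestOrbit : List (Fin N) → Maybe (List (Fin N))
  bestOrbit used = bestGo used (allFin N) nothing

  -- greedy decomposition; stops when every vertex is used (bestOrbit = nothing).
  -- Each step removes ≥ 1 vertex, so fuel N suffices.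
  decompGo : ℕ → List (Fin N) → List (List (Fin N))
  decompGo zero used = []
  decompGo (suc k) used with bestOrbit used
  ... | nothing = []
  ... | just o = o ∷ decompGo k (used ++ o)

  decomp : List (List (Fin N))
  decomp = decompGo N []

  ℓ : ℕ
  ℓ = length decomp

  C : Fin ℓ → List (Fin N)
  C i = lookup decomp i

  IsLast : Fin ℓ → Fin N → Set
  IsLast i y = last (C i) ≡ just y

  -- number of descents from C_i:  Descents i d  means  d(i) = d.
  data Descents : Fin ℓ → ℕ → Set where
    rho  : ∀ {i y} → IsLast i y → f y ∈ C i → Descents i 0
    step : ∀ {i k y d} → IsLast i y → ¬ (f y ∈ C i) → f y ∈ C k →
           Descents k d → Descents i (suc d)

{-# OPTIONS --safe #-}
-- If C_i is not a ρ-orbit and f(v_i) lies in C_j, then |C_i| < |C_j|.  Indeed j > i is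
-- impossible, since f(v_i) was still available when C_i was chosen and would have prolonged
-- it; and for j < i, at stage j the start of C_i had an orbit running through all of C_i and
-- on to f(v_i), so the greedily chosen C_j is longer than C_i.  A chain of d descents thus
-- meets d + 1 orbits of strictly increasing lengths, at least 1, 2, …, d + 1; since the orbits
-- are disjoint, (d + 1)(d + 2)/2 ≤ N, that is (2d + 3)² ≤ 1 + 8N.
module Submission where

open import Defs
open import Data.Nat using (ℕ; zero; suc; _+_; _*_; _∸_; _≤_; _<_; _≤?_; _/_; z≤n; s≤s)
open import Data.Nat.Properties
open import Data.Nat.DivMod using (m*n/n≡m; /-monoˡ-≤)
open import Data.Nat.Tactic.RingSolver using (solve-∀)
open import Algebra.Properties.CommutativeSemigroup +-commutativeSemigroup using (x∙yz≈y∙xz)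
open import Data.Fin as Fin using (Fin)
open import Data.Fin.Properties using (injective⇒≤)
open import Data.List using (List; []; _∷_; length; _++_; concat; allFin; last; lookup)
open import Data.List.Properties using (length-++; ++-assoc; ++-identityʳ)
open import Data.List.Membership.Propositional using (_∈_; _∉_)
open import Data.List.Membership.Propositional.Properties using (∈-++⁺ˡ; ∈-lookup; ∈-allFin)
import Data.List.Membership.DecPropositional as DecMembership
open import Data.List.Relation.Unary.Any using (here; there)
import Data.List.Relation.Unary.All as All
open import Data.List.Relation.Unary.Unique.Propositional using (Unique; []; _∷_)
import Data.List.Relation.Unary.Unique.Propositional.Properties as Unique
open import Data.List.Relation.Binary.Subset.Propositional using (_⊆_)
open import Data.List.Relation.Binary.Subset.Propositional.Properties using (⊆-refl; ⊆-trans; ∷⁺ʳ; xs⊆xs++ys)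
open import Data.Maybe using (Maybe; just; nothing)
open import Data.Maybe.Relation.Unary.All as MaybeAll using (just; nothing)
open import Data.Product using (∃₂; _×_; _,_)
open import Data.Sum using (_⊎_; inj₁; inj₂)
open import Data.Bool using (if_then_else_)
open import Data.Empty using (⊥-elim)
open import Relation.Nullary using (Dec; does; yes; no; contradiction)
open import Function using (_∘_; case_of_)
open import Relation.Binary.PropositionalEquality

Unique-lookup-injective : ∀ {A : Set} {xs : List A} → Unique xs →
                          ∀ i j → lookup xs i ≡ lookup xs j → i ≡ j
Unique-lookup-injective (x∉ ∷ _) Fin.zero Fin.zero _ = refl
Unique-lookup-injective (x∉ ∷ _) Fin.zero (Fin.suc j) eq = contradiction eq (All.lookup x∉ (∈-lookup j))
Unique-lookup-injective (x∉ ∷ _) (Fin.suc i) Fin.zero eq = contradiction (sym eq) (All.lookup x∉ (∈-lookup i))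
Unique-lookup-injective (_ ∷ u) (Fin.suc i) (Fin.suc j) eq = cong Fin.suc (Unique-lookup-injective u i j eq)

Unique⇒length≤ : ∀ {n} {xs : List (Fin n)} → Unique xs → length xs ≤ n
Unique⇒length≤ u = injective⇒≤ (Unique-lookup-injective u _ _)

last≡just⇒nonempty : ∀ {A : Set} {xs : List A} {y} → last xs ≡ just y → 1 ≤ length xs
last≡just⇒nonempty {xs = _ ∷ _} _ = s≤s z≤n

sumFrom : ℕ → ℕ → ℕ
sumFrom a zero = 0
sumFrom a (suc n) = a + sumFrom (suc a) n

sumFrom-closedForm : ∀ a n → sumFrom a n * 2 + n ≡ n * (a * 2 + n)
sumFrom-closedForm a zero = refl
sumFrom-closedForm a (suc n) = begin
    (a + sumFrom (suc a) n) * 2 + suc n       ≡⟨ regroup a (sumFrom (suc a) n) n ⟩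
    (sumFrom (suc a) n * 2 + n) + (a * 2 + 1) ≡⟨ cong (_+ (a * 2 + 1)) (sumFrom-closedForm (suc a) n) ⟩
    n * (suc a * 2 + n) + (a * 2 + 1)         ≡⟨ expand a n ⟩
    suc n * (a * 2 + suc n)                   ∎
  where
    open ≡-Reasoning
    regroup : ∀ a s n → (a + s) * 2 + suc n ≡ (s * 2 + n) + (a * 2 + 1)
    regroup = solve-∀
    expand : ∀ a n → n * (suc a * 2 + n) + (a * 2 + 1) ≡ suc n * (a * 2 + suc n)
    expand = solve-∀

odd²≡1+8*triangle : ∀ d → (d * 2 + 3) * (d * 2 + 3) ≡ 1 + 8 * sumFrom 1 (suc d)
odd²≡1+8*triangle d = +-cancelʳ-≡ (4 * suc d) _ _ (begin
    (d * 2 + 3) * (d * 2 + 3) + 4 * suc d       ≡⟨ square d ⟩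
    4 * (suc d * (1 * 2 + suc d)) + 1           ≡⟨ cong (λ t → 4 * t + 1) (sumFrom-closedForm 1 (suc d)) ⟨
    4 * (sumFrom 1 (suc d) * 2 + suc d) + 1     ≡⟨ unfold (sumFrom 1 (suc d)) d ⟩
    1 + 8 * sumFrom 1 (suc d) + 4 * suc d       ∎)
  where
    open ≡-Reasoning
    square : ∀ d → (d * 2 + 3) * (d * 2 + 3) + 4 * suc d ≡ 4 * (suc d * (1 * 2 + suc d)) + 1
    square = solve-∀
    unfold : ∀ s d → 4 * (s * 2 + suc d) + 1 ≡ 1 + 8 * s + 4 * suc d
    unfold = solve-∀

isqrt-go-maximal : ∀ x m k → k ≤ m → k * k ≤ x → k ≤ isqrt-go x m
isqrt-go-maximal x zero k k≤0 _ = k≤0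
isqrt-go-maximal x (suc m) k k≤m kk≤x = byTest (suc m * suc m ≤? x)
  where
    byTest : (m²≤x? : Dec (suc m * suc m ≤ x)) → k ≤ (if does m²≤x? then suc m else isqrt-go x m)
    byTest (yes _) = k≤m
    byTest (no m²≰x) with m≤n⇒m<n∨m≡n k≤m
    ... | inj₁ (s≤s k≤m′) = isqrt-go-maximal x m k k≤m′ kk≤x
    ... | inj₂ refl = contradiction kk≤x m²≰x

square≤⇒≤⌊√⌋ : ∀ {k x} → k * k ≤ x → k ≤ ⌊√ x ⌋
square≤⇒≤⌊√⌋ {zero} _ = z≤n
square≤⇒≤⌊√⌋ {k@(suc _)} {x} kk≤x = isqrt-go-maximal x x k (≤-trans (m≤m*n k k) kk≤x) kk≤x

triangle≤⇒≤descentBound : ∀ {N d} → sumFrom 1 (suc d) ≤ N → d ≤ descentBound N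
triangle≤⇒≤descentBound {N} {d} triangle≤N = begin
    d                              ≡⟨ m*n/n≡m d 2 ⟨
    d * 2 / 2                      ≡⟨ cong (_/ 2) (m+n∸n≡m (d * 2) 3) ⟨
    (d * 2 + 3 ∸ 3) / 2            ≤⟨ /-monoˡ-≤ 2 (∸-monoˡ-≤ 3 (square≤⇒≤⌊√⌋ {d * 2 + 3} odd²≤1+8N)) ⟩
    (⌊√ (1 + 8 * N) ⌋ ∸ 3) / 2     ∎
  where
    open ≤-Reasoning
    odd²≤1+8N : (d * 2 + 3) * (d * 2 + 3) ≤ 1 + 8 * N
    odd²≤1+8N = ≤-trans (≤-reflexive (odd²≡1+8*triangle d)) (s≤s (*-monoʳ-≤ 8 triangle≤N))

-- Distinctness of the orbits along a chain is never tracked: sumLengths≥ m counts only the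
-- orbits of length at least m, and each descent lowers the threshold past one more orbit.
keepIfAtLeast : ℕ → ℕ → ℕ
keepIfAtLeast m n with m ≤? n
... | yes _ = n
... | no _ = 0

keepIfAtLeast-antitone : ∀ {a b} n → a ≤ b → keepIfAtLeast b n ≤ keepIfAtLeast a n
keepIfAtLeast-antitone {a} {b} n a≤b with b ≤? n | a ≤? n
... | yes _ | yes _ = ≤-refl
... | yes b≤n | no a≰n = contradiction (≤-trans a≤b b≤n) a≰n
... | no _ | _ = z≤n

keepIfAtLeast≤ : ∀ m n → keepIfAtLeast m n ≤ n
keepIfAtLeast≤ m n with m ≤? n
... | yes _ = ≤-refl
... | no _ = z≤n

keepIfAtLeast-self : ∀ n → keepIfAtLeast n n ≡ n
keepIfAtLeast-self n with n ≤? n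
... | yes _ = refl
... | no n≰n = contradiction ≤-refl n≰n

keepIfAtLeast-below : ∀ {b n} → n < b → keepIfAtLeast b n ≡ 0
keepIfAtLeast-below {b} {n} n<b with b ≤? n
... | yes b≤n = contradiction b≤n (<⇒≱ n<b)
... | no _ = refl

sumLengths≥ : ∀ {A : Set} → ℕ → List (List A) → ℕ
sumLengths≥ m [] = 0
sumLengths≥ m (xs ∷ L) = keepIfAtLeast m (length xs) + sumLengths≥ m L

sumLengths≥-antitone : ∀ {A : Set} {a b} (L : List (List A)) → a ≤ b → sumLengths≥ b L ≤ sumLengths≥ a L
sumLengths≥-antitone [] _ = z≤n
sumLengths≥-antitone (xs ∷ L) a≤b =
  +-mono-≤ (keepIfAtLeast-antitone (length xs) a≤b) (sumLengths≥-antitone L a≤b)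

sumLengths≥-lookup : ∀ {A : Set} (L : List (List A)) i {b} → length (lookup L i) < b →
                     length (lookup L i) + sumLengths≥ b L ≤ sumLengths≥ (length (lookup L i)) L
sumLengths≥-lookup (xs ∷ L) Fin.zero {b} xs<b
  rewrite keepIfAtLeast-self (length xs) | keepIfAtLeast-below xs<b =
  +-monoʳ-≤ (length xs) (sumLengths≥-antitone L (<⇒≤ xs<b))
sumLengths≥-lookup (xs ∷ L) (Fin.suc i) {b} lᵢ<b = begin
    lᵢ + (keepIfAtLeast b (length xs) + sumLengths≥ b L)  ≡⟨ x∙yz≈y∙xz lᵢ (keepIfAtLeast b (length xs)) (sumLengths≥ b L) ⟩
    keepIfAtLeast b (length xs) + (lᵢ + sumLengths≥ b L)  ≤⟨ +-mono-≤ (keepIfAtLeast-antitone (length xs) (<⇒≤ lᵢ<b))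
                                                                           (sumLengths≥-lookup L i lᵢ<b) ⟩
    keepIfAtLeast lᵢ (length xs) + sumLengths≥ lᵢ L       ∎
  where
    open ≤-Reasoning
    lᵢ = length (lookup L i)

sumLengths≥≤length-concat : ∀ {A : Set} m (L : List (List A)) → sumLengths≥ m L ≤ length (concat L)
sumLengths≥≤length-concat m [] = z≤n
sumLengths≥≤length-concat m (xs ∷ L) rewrite length-++ xs {concat L} =
  +-mono-≤ (keepIfAtLeast≤ m (length xs)) (sumLengths≥≤length-concat m L)

module GreedyProperties {N : ℕ} (f : Fin N → Fin N) where
  open Greedy f
  open DecMembership {A = Fin N} Fin._≟_ using (_∈?_)

  data OrbitStep (k : ℕ) (A : List (Fin N)) (x : Fin N) : List (Fin N) → Set where
    stop     : f x ∈ x ∷ A → OrbitStep k A x (x ∷ [])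
    continue : f x ∉ x ∷ A → OrbitStep k A x (x ∷ orbitGo k (x ∷ A) (f x))

  -- The test is passed as an argument because `with` cannot find it in the unfolded goal.
  orbitStep : ∀ k A x → OrbitStep k A x (orbitGo (suc k) A x)
  orbitStep k A x = byTest (f x ∈? (x ∷ A))
    where
      byTest : (fx∈? : Dec (f x ∈ x ∷ A)) →
               OrbitStep k A x (x ∷ (if does fx∈? then [] else orbitGo k (x ∷ A) (f x)))
      byTest (yes fx∈) = stop fx∈
      byTest (no fx∉) = continue fx∉

  last-∷-orbitGo : ∀ k A x y → last (y ∷ orbitGo k A x) ≡ last (orbitGo k A x)
  last-∷-orbitGo zero A x y = refl
  last-∷-orbitGo (suc k) A x y = refl

  length-orbitGo-pos : ∀ k A x → 1 ≤ length (orbitGo k A x)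
  length-orbitGo-pos zero A x = s≤s z≤n
  length-orbitGo-pos (suc k) A x = s≤s z≤n

  orbitGo-fresh : ∀ k A x → x ∉ A → ∀ {z} → z ∈ orbitGo k A x → z ∉ A
  orbitGo-fresh zero A x x∉A (here refl) = x∉A
  orbitGo-fresh (suc k) A x x∉A = freshStep (orbitStep k A x)
    where
      freshStep : ∀ {o z} → OrbitStep k A x o → z ∈ o → z ∉ A
      freshStep (stop _) (here refl) = x∉A
      freshStep (continue _) (here refl) = x∉A
      freshStep (continue fx∉) (there z∈) z∈A = orbitGo-fresh k (x ∷ A) (f x) fx∉ z∈ (there z∈A)

  orbitGo-unique : ∀ k A x → x ∉ A → Unique (orbitGo k A x)
  orbitGo-unique zero A x _ = All.[] ∷ []
  orbitGo-unique (suc k) A x x∉A = uniqueStep (orbitStep k A x)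
    where
      uniqueStep : ∀ {o} → OrbitStep k A x o → Unique o
      uniqueStep (stop _) = All.[] ∷ []
      uniqueStep (continue fx∉) =
        All.tabulate (λ z∈ x≡z → orbitGo-fresh k (x ∷ A) (f x) fx∉ z∈ (here (sym x≡z)))
          ∷ orbitGo-unique k (x ∷ A) (f x) fx∉

  -- The length hypothesis says that the fuel k was not exhausted.
  orbitGo-closed : ∀ k A x {y} → last (orbitGo k A x) ≡ just y → length (orbitGo k A x) ≤ k →
                   f y ∈ orbitGo k A x ⊎ f y ∈ A
  orbitGo-closed zero A x _ ()
  orbitGo-closed (suc k) A x = closedStep (orbitStep k A x)
    where
      shift : ∀ {z o} → z ∈ o ⊎ z ∈ x ∷ A → z ∈ x ∷ o ⊎ z ∈ A
      shift (inj₁ z∈o) = inj₁ (there z∈o)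
      shift (inj₂ (here z≡x)) = inj₁ (here z≡x)
      shift (inj₂ (there z∈A)) = inj₂ z∈A
      closedStep : ∀ {o y} → OrbitStep k A x o → last o ≡ just y → length o ≤ suc k → f y ∈ o ⊎ f y ∈ A
      closedStep (stop (here fx≡x)) refl _ = inj₁ (here fx≡x)
      closedStep (stop (there fx∈A)) refl _ = inj₂ fx∈A
      closedStep (continue _) ly len≤ =
        shift (orbitGo-closed k (x ∷ A) (f x) (trans (sym (last-∷-orbitGo k (x ∷ A) (f x) x)) ly) (≤-pred len≤))

  -- Avoiding fewer vertices, the walk from x follows the same path and then can step on to f y.
  orbitGo-extends : ∀ k {A B} x {y} → B ⊆ A → last (orbitGo k A x) ≡ just y →
                    f y ∉ orbitGo k A x → f y ∉ B → length (orbitGo k A x) ≤ k →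
                    length (orbitGo k A x) < length (orbitGo k B x)
  orbitGo-extends zero x _ _ _ _ ()
  orbitGo-extends (suc k) {A} {B} x {y} B⊆A = extendsStep (orbitStep k A x) (orbitStep k B x)
    where
      extendsStep : ∀ {o o′} → OrbitStep k A x o → OrbitStep k B x o′ → last o ≡ just y →
                    f y ∉ o → f y ∉ B → length o ≤ suc k → length o < length o′
      extendsStep (stop _) (stop (here fx≡x)) refl fy∉ _ _ = contradiction (here fx≡x) fy∉
      extendsStep (stop _) (stop (there fx∈B)) refl _ fy∉B _ = contradiction fx∈B fy∉B
      extendsStep (stop _) (continue _) _ _ _ _ = s≤s (length-orbitGo-pos k (x ∷ B) (f x))
      extendsStep (continue fx∉) (stop fx∈) _ _ _ _ = contradiction (∷⁺ʳ x B⊆A fx∈) fx∉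
      extendsStep (continue _) (continue _) ly fy∉ fy∉B len≤ =
        s≤s (orbitGo-extends k (f x) (∷⁺ʳ x B⊆A) (trans (sym (last-∷-orbitGo k (x ∷ A) (f x) x)) ly)
               (λ fy∈ → fy∉ (there fy∈)) fy∉x∷B (≤-pred len≤))
        where
          fy∉x∷B : f y ∉ x ∷ B
          fy∉x∷B (here fy≡x) = fy∉ (here fy≡x)
          fy∉x∷B (there fy∈B) = fy∉B fy∈B

  orbit-unique : ∀ U s → s ∉ U → Unique (orbit U s)
  orbit-unique = orbitGo-unique N

  orbit-fresh : ∀ U s → s ∉ U → ∀ {z} → z ∈ orbit U s → z ∉ U
  orbit-fresh = orbitGo-fresh N

  length-orbit≤N : ∀ U s → s ∉ U → length (orbit U s) ≤ N
  length-orbit≤N U s s∉U = Unique⇒length≤ (orbit-unique U s s∉U)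

  lengthᴹ : Maybe (List (Fin N)) → ℕ
  lengthᴹ nothing = 0
  lengthᴹ (just o) = length o

  IsFreeOrbit : List (Fin N) → List (Fin N) → Set
  IsFreeOrbit U o = ∃₂ λ s (_ : s ∉ U) → o ≡ orbit U s

  data Longer (o o′ : List (Fin N)) : Maybe (List (Fin N)) → Set where
    takeNew : length o < length o′ → Longer o o′ (just o′)
    keepOld : length o′ ≤ length o → Longer o o′ (just o)

  longer : ∀ o o′ → Longer o o′ (if does (suc (length o) ≤? length o′) then just o′ else just o)
  longer o o′ = byTest (suc (length o) ≤? length o′)
    where
      byTest : (o<o′? : Dec (length o < length o′)) → Longer o o′ (if does o<o′? then just o′ else just o)
      byTest (yes o<o′) = takeNew o<o′
      byTest (no o≮o′) = keepOld (≮⇒≥ o≮o′)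

  bestGo-monotone : ∀ U vs acc → lengthᴹ acc ≤ lengthᴹ (bestGo U vs acc)
  bestGo-monotone U [] acc = ≤-refl
  bestGo-monotone U (v ∷ vs) acc with v ∈? U
  ... | yes _ = bestGo-monotone U vs acc
  ... | no _ with acc
  ...   | nothing = z≤n
  ...   | just o = viaLonger (longer o (orbit U v))
    where
      viaLonger : ∀ {m} → Longer o (orbit U v) m → length o ≤ lengthᴹ (bestGo U vs m)
      viaLonger (takeNew o<ov) = ≤-trans (<⇒≤ o<ov) (bestGo-monotone U vs _)
      viaLonger (keepOld _) = bestGo-monotone U vs _

  bestGo-maximal : ∀ U vs acc {s} → s ∈ vs → s ∉ U → length (orbit U s) ≤ lengthᴹ (bestGo U vs acc)
  bestGo-maximal U (v ∷ vs) acc s∈ s∉U with v ∈? U | s∈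
  ... | yes v∈U | here refl = contradiction v∈U s∉U
  ... | yes _ | there s∈vs = bestGo-maximal U vs acc s∈vs s∉U
  ... | no _ | here refl with acc
  ...   | nothing = bestGo-monotone U vs _
  ...   | just o = viaLonger (longer o (orbit U v))
    where
      viaLonger : ∀ {m} → Longer o (orbit U v) m → length (orbit U v) ≤ lengthᴹ (bestGo U vs m)
      viaLonger (takeNew _) = bestGo-monotone U vs _
      viaLonger (keepOld ov≤o) = ≤-trans ov≤o (bestGo-monotone U vs _)
  bestGo-maximal U (v ∷ vs) acc s∈ s∉U | no _ | there s∈vs with acc
  ... | nothing = bestGo-maximal U vs _ s∈vs s∉U
  ... | just o = bestGo-maximal U vs _ s∈vs s∉U

  bestGo-free : ∀ U vs acc → MaybeAll.All (IsFreeOrbit U) acc →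
                MaybeAll.All (IsFreeOrbit U) (bestGo U vs acc)
  bestGo-free U [] acc free = free
  bestGo-free U (v ∷ vs) acc free with v ∈? U
  ... | yes _ = bestGo-free U vs acc free
  ... | no v∉U with acc | free
  ...   | nothing | _ = bestGo-free U vs _ (just (v , v∉U , refl))
  ...   | just o | free-o = viaLonger (longer o (orbit U v))
    where
      viaLonger : ∀ {m} → Longer o (orbit U v) m → MaybeAll.All (IsFreeOrbit U) (bestGo U vs m)
      viaLonger (takeNew _) = bestGo-free U vs _ (just (v , v∉U , refl))
      viaLonger (keepOld _) = bestGo-free U vs _ free-o

  data GreedyChoice (U : List (Fin N)) : Maybe (List (Fin N)) → Set where
    none : GreedyChoice U nothing
    some : ∀ {s} → s ∉ U → (∀ {t} → t ∉ U → length (orbit U t) ≤ length (orbit U s)) →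
           GreedyChoice U (just (orbit U s))

  bestOrbit-greedy : ∀ U → GreedyChoice U (bestOrbit U)
  bestOrbit-greedy U
    with bestOrbit U | bestGo-free U (allFin N) nothing nothing
       | (λ {t} → bestGo-maximal U (allFin N) nothing {t} (∈-allFin t))
  ... | nothing | _ | _ = none
  ... | just _ | just (s , s∉U , refl) | maximal = some s∉U maximal

  decompGo-orbit : ∀ k U j → ∃₂ λ W t → U ⊆ W × t ∉ W × lookup (decompGo k U) j ≡ orbit W t
  decompGo-orbit (suc k) U j with bestOrbit U | bestOrbit-greedy U
  decompGo-orbit (suc k) U () | nothing | none
  decompGo-orbit (suc k) U Fin.zero | just _ | some {s} s∉U _ = U , s , ⊆-refl , s∉U , refl
  decompGo-orbit (suc k) U (Fin.suc j) | just o | some _ _ with decompGo-orbit k (U ++ o) j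
  ... | W , t , U++o⊆W , t∉W , eq = W , t , ⊆-trans (xs⊆xs++ys U o) U++o⊆W , t∉W , eq

  decompGo-fresh : ∀ k U j {z} → z ∈ lookup (decompGo k U) j → z ∉ U
  decompGo-fresh k U j z∈ z∈U with decompGo-orbit k U j
  ... | W , t , U⊆W , t∉W , eq = orbit-fresh W t t∉W (subst (_ ∈_) eq z∈) (U⊆W z∈U)

  decompGo-unique : ∀ k U → Unique U → Unique (U ++ concat (decompGo k U))
  decompGo-unique zero U uU = subst Unique (sym (++-identityʳ U)) uU
  decompGo-unique (suc k) U uU with bestOrbit U | bestOrbit-greedy U
  ... | nothing | none = subst Unique (sym (++-identityʳ U)) uU
  ... | just _ | some {s} s∉U _ =
    subst Unique (++-assoc U (orbit U s) _)
      (decompGo-unique k (U ++ orbit U s)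
        (Unique.++⁺ uU (orbit-unique U s s∉U) (λ (z∈U , z∈o) → orbit-fresh U s s∉U z∈o z∈U)))

  decompGo-descent : ∀ k U i j {y} → last (lookup (decompGo k U) i) ≡ just y →
                     f y ∉ lookup (decompGo k U) i → f y ∈ lookup (decompGo k U) j →
                     length (lookup (decompGo k U) i) < length (lookup (decompGo k U) j)
  decompGo-descent (suc k) U i j with bestOrbit U | bestOrbit-greedy U
  decompGo-descent (suc k) U () j | nothing | none
  decompGo-descent (suc k) U Fin.zero Fin.zero | just _ | some _ _ = λ _ fy∉ fy∈ → contradiction fy∈ fy∉
  decompGo-descent (suc k) U Fin.zero (Fin.suc j) | just _ | some {s} s∉U _ = λ ly fy∉ fy∈ →
    ⊥-elim (case orbitGo-closed N U s ly (length-orbit≤N U s s∉U) of λ where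
      (inj₁ fy∈o) → contradiction fy∈o fy∉
      (inj₂ fy∈U) → decompGo-fresh k (U ++ orbit U s) j fy∈ (∈-++⁺ˡ fy∈U))
  decompGo-descent (suc k) U (Fin.suc i) Fin.zero {y} | just _ | some {s} s∉U maximal
    with decompGo-orbit k (U ++ orbit U s) i
  ... | W , t , U++o⊆W , t∉W , eq =
    subst (λ o → last o ≡ just y → f y ∉ o → f y ∈ orbit U s → length o < length (orbit U s)) (sym eq)
      λ ly fy∉ fy∈o →
        ≤-trans (orbitGo-extends N t U⊆W ly fy∉ (orbit-fresh U s s∉U fy∈o) (length-orbit≤N W t t∉W))
                (maximal (t∉W ∘ U⊆W))
    where U⊆W = ⊆-trans (xs⊆xs++ys U (orbit U s)) U++o⊆W
  decompGo-descent (suc k) U (Fin.suc i) (Fin.suc j) | just o | some _ _ = decompGo-descent k (U ++ o) i j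

  descents⇒sumFrom≤ : ∀ {i d} → Descents i d → ∀ {a} → a ≤ length (C i) →
                      sumFrom a (suc d) ≤ sumLengths≥ (length (C i)) decomp
  descents⇒sumFrom≤ {i} (rho _ _) {a} a≤Cᵢ = begin
    a + 0                                                    ≡⟨ +-identityʳ a ⟩
    a                                                        ≤⟨ a≤Cᵢ ⟩
    length (C i)                                             ≤⟨ m≤m+n _ _ ⟩
    length (C i) + sumLengths≥ (suc (length (C i))) decomp   ≤⟨ sumLengths≥-lookup decomp i ≤-refl ⟩
    sumLengths≥ (length (C i)) decomp                        ∎
    where open ≤-Reasoning
  descents⇒sumFrom≤ {i} (step {k = k} {d = d} ly fy∉ fy∈ descents) {a} a≤Cᵢ = begin
    a + sumFrom (suc a) (suc d)                              ≤⟨ +-monoʳ-≤ a (descents⇒sumFrom≤ descents (≤-trans (s≤s a≤Cᵢ) Cᵢ<Cₖ)) ⟩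
    a + sumLengths≥ (length (C k)) decomp                    ≤⟨ +-monoˡ-≤ _ a≤Cᵢ ⟩
    length (C i) + sumLengths≥ (length (C k)) decomp         ≤⟨ sumLengths≥-lookup decomp i Cᵢ<Cₖ ⟩
    sumLengths≥ (length (C i)) decomp                        ∎
    where
      open ≤-Reasoning
      Cᵢ<Cₖ = decompGo-descent N [] i k ly fy∉ fy∈

  descents⇒triangle≤N : ∀ {i d} → Descents i d → sumFrom 1 (suc d) ≤ N
  descents⇒triangle≤N {i} {d} descents = begin
    sumFrom 1 (suc d)                    ≤⟨ descents⇒sumFrom≤ descents (nonempty descents) ⟩
    sumLengths≥ (length (C i)) decomp    ≤⟨ sumLengths≥≤length-concat _ decomp ⟩
    length (concat decomp)               ≤⟨ Unique⇒length≤ (decompGo-unique N [] []) ⟩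
    N                                    ∎
    where
      open ≤-Reasoning
      nonempty : ∀ {i d} → Descents i d → 1 ≤ length (C i)
      nonempty {i} (rho vᵢ _) = last≡just⇒nonempty {xs = C i} vᵢ
      nonempty {i} (step vᵢ _ _ _) = last≡just⇒nonempty {xs = C i} vᵢ

theorem3p14 : (N : ℕ) → 1 ≤ N → (f : Fin N → Fin N) →
    (i : Fin (Greedy.ℓ f)) (d : ℕ) → Greedy.Descents f i d → d ≤ descentBound N
theorem3p14 N _ f i d descents =
  triangle≤⇒≤descentBound (GreedyProperties.descents⇒triangle≤N f descents)
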